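{- For every $n\in\mathbb{N}$, the number of pairs $(u,v)\in L_n\times L_n$ such that $\binom{u}{v}>0$ is equal to $3^n$.
   Context: Words are over the alphabet $\{0,1\}$. For finite words $u,v$, the binomial coefficient $\binom{u}{v}$ is the number of times $v$ occurs as a (not necessarily contiguous) subsequence of $u$; $\binom{u}{\varepsilon}=1$. Let $L=\{\varepsilon\}\cup 1\{0,1\}^*$ (base-$2$ expansions of non-negative integers without leading zeroes, $\varepsilon$ the empty word) and $L_n$ the set of words of $L$ of length at most $n$. -}

module Defs where

open import Data.Bool using (Bool; true; false; if_then_else_)
open import Data.Nat using (ℕ; zero; suc; _+_; _<_; _<?_)
open import Data.List using (List; []; _∷_; map; concatMap; length; filter; cartesianProduct; _++_)
open import Data.Product using (_×_; _,_; proj₁; proj₂)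
open import Relation.Binary.PropositionalEquality using (_≡_)

-- Letters: false = 0, true = 1.  Words are lists of letters.
Word : Set
Word = List Bool

-- Binomial coefficient of words: number of occurrences of v as a
-- (scattered) subsequence of u.  Standard recursion:
--   binom u ε = 1,  binom ε (bv) = 0,
--   binom (ua) (vb) = binom u (vb) + [a = b] binom u v
-- (here written with first letters, which is equivalent).
eqB : Bool → Bool → Bool
eqB true true = true
eqB false false = true
eqB _ _ = false

binom : Word → Word → ℕ
binom u [] = 1
binom [] (b ∷ v) = 0
binom (a ∷ u) (b ∷ v) = binom u (b ∷ v) + (if eqB a b then binom u v else 0)

wordsOfLength : ℕ → List Word
wordsOfLength zero = [] ∷ []
wordsOfLength (suc n) = concatMap (λ w → (false ∷ w) ∷ (true ∷ w) ∷ []) (wordsOfLength n)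

wordsUpTo : ℕ → List Word
wordsUpTo zero = wordsOfLength zero
wordsUpTo (suc n) = wordsUpTo n ++ wordsOfLength (suc n)

-- L = {ε} ∪ 1{0,1}* : base-2 expansions without leading zeroes.
inL : Word → Bool
inL [] = true
inL (true ∷ _) = true
inL (false ∷ _) = false

Ln : ℕ → List Word
Ln n = filter (λ w → Data.Bool._≟_ (inL w) true) (wordsUpTo n)
  where import Data.Bool

countPositivePairs : ℕ → ℕ
countPositivePairs n =
  length (filter (λ p → 0 <? binom (proj₁ p) (proj₂ p)) (cartesianProduct (Ln n) (Ln n)))

module Submission where

-- Write W j for the words of length j and [v ≼ u] ∈ {0,1} for the indicator
-- of "v is a subword of u".  Every nonempty word of L is 1w, and matching the
-- leading 1s gives [1w ≼ 1u] = [w ≼ u]; so the count equals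
--   1 + Σ_{j<n} Σ_{u ∈ W j} (1 + Σ_{k<n} Σ_{w ∈ W k} [w ≼ u]).
-- The heart of the proof is the table  pairs j k = Σ_{u∈W j} Σ_{w∈W k} [w ≼ u].
-- Summing [b w ≼ a u] over the first letters a, b and using
--   [b w ≼ a u] = [w ≼ u] if a = b,  [b w ≼ u] otherwise
-- gives the Pascal-like recursion  pairs (j+1) (k+1) = 2 pairs j k + pairs j (k+1),
-- with pairs j 0 = 2^j and pairs 0 (k+1) = 0.  From it, by induction on j,
--   Σ_{k<N} pairs j k + 2^j = 2·3^j   whenever j < N,
-- so the row of u-length j contributes 2·3^j and the count is
-- 1 + Σ_{j<n} 2·3^j = 3^n.

open import Defs
open import Data.Nat using (ℕ; _^_)
open import Relation.Binary.PropositionalEquality using (_≡_)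

open import Data.Bool using (Bool; true; false; if_then_else_)
open import Data.Bool using () renaming (_≟_ to _≟ᵇ_)
open import Data.Nat using (zero; suc; _+_; _*_; _<_; _<?_; s≤s)
open import Data.Nat.Properties using (+-assoc; +-comm; +-identityʳ; +-suc; *-zeroʳ; *-distribˡ-+; m+n≡0⇒m≡0; n<1+n; m<n⇒m<1+n)
open import Data.Nat.Tactic.RingSolver using (solve-∀)
open import Data.List using (List; []; _∷_; map; concatMap; length; filter; cartesianProduct; _++_)
open import Data.Product using (_×_; _,_; proj₁; proj₂)
open import Relation.Binary.PropositionalEquality using (refl; sym; trans; cong; cong₂; module ≡-Reasoning)
open import Relation.Nullary using (Dec; does)
open import Relation.Unary using (Pred; Decidable)
open import Level using (0ℓ)

open ≡-Reasoning

∑ : {A : Set} → List A → (A → ℕ) → ℕ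
∑ [] f = 0
∑ (x ∷ xs) f = f x + ∑ xs f

syntax ∑ xs (λ x → e) = ∑[ x ∈ xs ] e

∑-cong : {A : Set} {f g : A → ℕ} → (∀ x → f x ≡ g x) → (xs : List A) → ∑ xs f ≡ ∑ xs g
∑-cong f≗g [] = refl
∑-cong f≗g (x ∷ xs) = cong₂ _+_ (f≗g x) (∑-cong f≗g xs)

∑-zero : {A : Set} (xs : List A) → ∑[ x ∈ xs ] 0 ≡ 0
∑-zero [] = refl
∑-zero (x ∷ xs) = ∑-zero xs

∑-+ : {A : Set} (f g : A → ℕ) (xs : List A) → ∑[ x ∈ xs ] (f x + g x) ≡ ∑ xs f + ∑ xs g
∑-+ f g [] = refl
∑-+ f g (x ∷ xs) = begin
  (f x + g x) + ∑[ y ∈ xs ] (f y + g y)  ≡⟨ cong ((f x + g x) +_) (∑-+ f g xs) ⟩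
  (f x + g x) + (∑ xs f + ∑ xs g)        ≡⟨ interchange (f x) (g x) (∑ xs f) (∑ xs g) ⟩
  (f x + ∑ xs f) + (g x + ∑ xs g)        ∎
  where
  interchange : ∀ a b c d → (a + b) + (c + d) ≡ (a + c) + (b + d)
  interchange = solve-∀

∑-++ : {A : Set} (f : A → ℕ) (xs ys : List A) → ∑ (xs ++ ys) f ≡ ∑ xs f + ∑ ys f
∑-++ f [] ys = refl
∑-++ f (x ∷ xs) ys = trans (cong (f x +_) (∑-++ f xs ys)) (sym (+-assoc (f x) _ _))

∑-map : {A B : Set} (g : A → B) (f : B → ℕ) (xs : List A) → ∑ (map g xs) f ≡ ∑[ x ∈ xs ] f (g x)
∑-map g f [] = refl
∑-map g f (x ∷ xs) = cong (f (g x) +_) (∑-map g f xs)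

∑-concatMap : {A B : Set} (g : A → List B) (f : B → ℕ) (xs : List A) →
              ∑ (concatMap g xs) f ≡ ∑[ x ∈ xs ] ∑ (g x) f
∑-concatMap g f [] = refl
∑-concatMap g f (x ∷ xs) = trans (∑-++ f (g x) _) (cong (∑ (g x) f +_) (∑-concatMap g f xs))

∑-filter : {A : Set} {P : Pred A 0ℓ} (P? : Decidable P) (f : A → ℕ) (xs : List A) →
           ∑ (filter P? xs) f ≡ ∑[ x ∈ xs ] (if does (P? x) then f x else 0)
∑-filter P? f [] = refl
∑-filter P? f (x ∷ xs) with does (P? x)
... | false = ∑-filter P? f xs
... | true = cong (f x +_) (∑-filter P? f xs)

∑-cartesianProduct : {A B : Set} (f : A × B → ℕ) (xs : List A) (ys : List B) →
                     ∑ (cartesianProduct xs ys) f ≡ ∑[ x ∈ xs ] ∑[ y ∈ ys ] f (x , y)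
∑-cartesianProduct f [] ys = refl
∑-cartesianProduct f (x ∷ xs) ys =
  trans (∑-++ f (map (x ,_) ys) _) (cong₂ _+_ (∑-map (x ,_) f ys) (∑-cartesianProduct f xs ys))

∑-scale : {A : Set} (a : ℕ) (f : A → ℕ) (xs : List A) → ∑[ x ∈ xs ] (a * f x) ≡ a * ∑ xs f
∑-scale a f [] = sym (*-zeroʳ a)
∑-scale a f (x ∷ xs) = trans (cong (a * f x +_) (∑-scale a f xs)) (sym (*-distribˡ-+ a (f x) (∑ xs f)))

length-as-∑ : {A : Set} (xs : List A) → length xs ≡ ∑[ x ∈ xs ] 1
length-as-∑ [] = refl
length-as-∑ (x ∷ xs) = cong suc (length-as-∑ xs)

∑< : ℕ → (ℕ → ℕ) → ℕ
∑< zero f = 0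
∑< (suc n) f = ∑< n f + f n

syntax ∑< n (λ k → e) = ∑[ k < n ] e

∑<-cong : {f g : ℕ → ℕ} (n : ℕ) → (∀ k → k < n → f k ≡ g k) → ∑< n f ≡ ∑< n g
∑<-cong zero f≗g = refl
∑<-cong (suc n) f≗g =
  cong₂ _+_ (∑<-cong n (λ k k<n → f≗g k (m<n⇒m<1+n k<n)))
            (f≗g n (n<1+n n))

∑<-zero : (n : ℕ) → ∑[ k < n ] 0 ≡ 0
∑<-zero zero = refl
∑<-zero (suc n) = trans (+-identityʳ _) (∑<-zero n)

∑<-+ : (f g : ℕ → ℕ) (n : ℕ) → ∑[ k < n ] (f k + g k) ≡ ∑< n f + ∑< n g
∑<-+ f g zero = refl
∑<-+ f g (suc n) = trans (cong (_+ (f n + g n)) (∑<-+ f g n)) (interchange (∑< n f) (∑< n g) (f n) (g n))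
  where
  interchange : ∀ a b c d → (a + b) + (c + d) ≡ (a + c) + (b + d)
  interchange = solve-∀

∑<-scale : (a : ℕ) (f : ℕ → ℕ) (n : ℕ) → ∑[ k < n ] (a * f k) ≡ a * ∑< n f
∑<-scale a f zero = sym (*-zeroʳ a)
∑<-scale a f (suc n) = trans (cong (_+ a * f n) (∑<-scale a f n)) (sym (*-distribˡ-+ a (∑< n f) (f n)))

∑<-head : (f : ℕ → ℕ) (n : ℕ) → ∑< (suc n) f ≡ f 0 + ∑[ k < n ] f (suc k)
∑<-head f zero = +-comm 0 (f 0)
∑<-head f (suc n) = trans (cong (_+ f (suc n)) (∑<-head f n)) (+-assoc (f 0) _ _)

∑-∑<-comm : {A : Set} (f : A → ℕ → ℕ) (xs : List A) (n : ℕ) →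
            ∑[ x ∈ xs ] ∑[ k < n ] f x k ≡ ∑[ k < n ] ∑[ x ∈ xs ] f x k
∑-∑<-comm f xs zero = ∑-zero xs
∑-∑<-comm f xs (suc n) =
  trans (∑-+ (λ x → ∑< n (f x)) (λ x → f x n) xs) (cong (_+ ∑[ x ∈ xs ] f x n) (∑-∑<-comm f xs n))

geometric : (n : ℕ) → 1 + ∑[ j < n ] (2 * 3 ^ j) ≡ 3 ^ n
geometric zero = refl
geometric (suc n) = begin
  1 + (∑[ j < n ] (2 * 3 ^ j) + 2 * 3 ^ n)  ≡⟨ sym (+-assoc 1 (∑[ j < n ] (2 * 3 ^ j)) (2 * 3 ^ n)) ⟩
  (1 + ∑[ j < n ] (2 * 3 ^ j)) + 2 * 3 ^ n  ≡⟨ cong (_+ 2 * 3 ^ n) (geometric n) ⟩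
  3 ^ n + 2 * 3 ^ n                         ∎

∑-wordsOfLength-suc : (f : Word → ℕ) (m : ℕ) →
  ∑ (wordsOfLength (suc m)) f ≡ ∑[ w ∈ wordsOfLength m ] (f (false ∷ w) + f (true ∷ w))
∑-wordsOfLength-suc f m =
  trans (∑-concatMap _ f (wordsOfLength m))
        (∑-cong (λ w → cong (f (false ∷ w) +_) (+-identityʳ (f (true ∷ w)))) (wordsOfLength m))

count-wordsOfLength : (m : ℕ) → ∑[ w ∈ wordsOfLength m ] 1 ≡ 2 ^ m
count-wordsOfLength zero = refl
count-wordsOfLength (suc m) = begin
  ∑ (wordsOfLength (suc m)) (λ _ → 1)       ≡⟨ ∑-wordsOfLength-suc (λ _ → 1) m ⟩
  ∑[ w ∈ wordsOfLength m ] (1 + 1)           ≡⟨ ∑-+ (λ _ → 1) (λ _ → 1) (wordsOfLength m) ⟩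
  ∑[ w ∈ wordsOfLength m ] 1 + ∑[ w ∈ wordsOfLength m ] 1
                                             ≡⟨ cong₂ _+_ (count-wordsOfLength m) (count-wordsOfLength m) ⟩
  2 ^ m + 2 ^ m                              ≡⟨ cong (2 ^ m +_) (sym (+-identityʳ (2 ^ m))) ⟩
  2 * 2 ^ m                                  ∎

∑-Ln : (f : Word → ℕ) (n : ℕ) → ∑ (Ln n) f ≡ f [] + ∑[ j < n ] ∑[ w ∈ wordsOfLength j ] f (true ∷ w)
∑-Ln f n = trans (∑-filter (λ w → inL w ≟ᵇ true) f (wordsUpTo n)) (∑-gated n)
  where
  gated : Word → ℕ
  gated w = if does (inL w ≟ᵇ true) then f w else 0

  ∑-gated : (n : ℕ) → ∑ (wordsUpTo n) gated ≡ f [] + ∑[ j < n ] ∑[ w ∈ wordsOfLength j ] f (true ∷ w)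
  ∑-gated zero = refl
  ∑-gated (suc n) =
    trans (∑-++ gated (wordsUpTo n) (wordsOfLength (suc n)))
          (trans (cong₂ _+_ (∑-gated n) (∑-wordsOfLength-suc gated n)) (+-assoc (f []) _ _))

-- Occurrences of v in w are occurrences in aw, so absence from aw implies absence from w.
binom-tail-zero : (a : Bool) (w v : Word) → binom (a ∷ w) v ≡ 0 → binom w v ≡ 0
binom-tail-zero a w [] ()
binom-tail-zero a w (b ∷ v) h = m+n≡0⇒m≡0 (binom w (b ∷ v)) h

binom-extend-zero : (b : Bool) (w v : Word) → binom w v ≡ 0 → binom w (b ∷ v) ≡ 0
binom-extend-zero b [] v h = refl
binom-extend-zero b (a ∷ w) v h
  rewrite binom-extend-zero b w v (binom-tail-zero a w v h) with eqB a b
... | true = binom-tail-zero a w v h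
... | false = refl

positive : ℕ → ℕ
positive zero = 0
positive (suc _) = 1

subword : Word → Word → ℕ
subword u v = positive (binom u v)

positive-+ : (x y : ℕ) → (y ≡ 0 → x ≡ 0) → positive (x + y) ≡ positive y
positive-+ x zero h rewrite h refl = refl
positive-+ x (suc y) h rewrite +-suc x y = refl

-- Greedy matching of the first letter:
--   [b v ≼ a w] = [v ≼ w] if a = b,  [b v ≼ w] otherwise.
subword-cons : (a b : Bool) (w v : Word) →
               subword (a ∷ w) (b ∷ v) ≡ (if eqB a b then subword w v else subword w (b ∷ v))
subword-cons a b w v with eqB a b
... | true = positive-+ (binom w (b ∷ v)) (binom w v) (binom-extend-zero b w v)
... | false = cong positive (+-identityʳ _)

pairs : ℕ → ℕ → ℕ
pairs j k = ∑[ u ∈ wordsOfLength j ] ∑[ w ∈ wordsOfLength k ] subword u w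

pairs-zero : (j : ℕ) → pairs j 0 ≡ 2 ^ j
pairs-zero = count-wordsOfLength

pairs-empty : (k : ℕ) → pairs 0 (suc k) ≡ 0
pairs-empty k = trans (+-identityʳ _) (trans (∑-wordsOfLength-suc (subword []) k) (∑-zero (wordsOfLength k)))

first-letters : (u w : Word) →
  (subword (false ∷ u) (false ∷ w) + subword (false ∷ u) (true ∷ w))
    + (subword (true ∷ u) (false ∷ w) + subword (true ∷ u) (true ∷ w))
  ≡ 2 * subword u w + (subword u (false ∷ w) + subword u (true ∷ w))
first-letters u w
  rewrite subword-cons false false u w | subword-cons false true u w
        | subword-cons true false u w | subword-cons true true u w =
  rearrange (subword u w) (subword u (false ∷ w)) (subword u (true ∷ w))
  where
  rearrange : ∀ s s₀ s₁ → (s + s₁) + (s₀ + s) ≡ 2 * s + (s₀ + s₁)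
  rearrange = solve-∀

column-step : (k : ℕ) (u : Word) →
  ∑ (wordsOfLength (suc k)) (subword (false ∷ u)) + ∑ (wordsOfLength (suc k)) (subword (true ∷ u))
  ≡ 2 * ∑ (wordsOfLength k) (subword u) + ∑ (wordsOfLength (suc k)) (subword u)
column-step k u = begin
  ∑ (W (suc k)) (subword (false ∷ u)) + ∑ (W (suc k)) (subword (true ∷ u))
    ≡⟨ cong₂ _+_ (∑-wordsOfLength-suc (subword (false ∷ u)) k) (∑-wordsOfLength-suc (subword (true ∷ u)) k) ⟩
  ∑[ w ∈ W k ] (subword (false ∷ u) (false ∷ w) + subword (false ∷ u) (true ∷ w))
    + ∑[ w ∈ W k ] (subword (true ∷ u) (false ∷ w) + subword (true ∷ u) (true ∷ w))
    ≡⟨ sym (∑-+ _ _ (W k)) ⟩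
  ∑[ w ∈ W k ] ((subword (false ∷ u) (false ∷ w) + subword (false ∷ u) (true ∷ w))
               + (subword (true ∷ u) (false ∷ w) + subword (true ∷ u) (true ∷ w)))
    ≡⟨ ∑-cong (first-letters u) (W k) ⟩
  ∑[ w ∈ W k ] (2 * subword u w + (subword u (false ∷ w) + subword u (true ∷ w)))
    ≡⟨ ∑-+ _ _ (W k) ⟩
  ∑[ w ∈ W k ] (2 * subword u w) + ∑[ w ∈ W k ] (subword u (false ∷ w) + subword u (true ∷ w))
    ≡⟨ cong₂ _+_ (∑-scale 2 (subword u) (W k)) (sym (∑-wordsOfLength-suc (subword u) k)) ⟩
  2 * ∑ (W k) (subword u) + ∑ (W (suc k)) (subword u) ∎
  where
  W = wordsOfLength

pairs-step : (j k : ℕ) → pairs (suc j) (suc k) ≡ 2 * pairs j k + pairs j (suc k)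
pairs-step j k = begin
  pairs (suc j) (suc k)
    ≡⟨ ∑-wordsOfLength-suc (λ u → ∑ (W (suc k)) (subword u)) j ⟩
  ∑[ u ∈ W j ] (∑ (W (suc k)) (subword (false ∷ u)) + ∑ (W (suc k)) (subword (true ∷ u)))
    ≡⟨ ∑-cong (column-step k) (W j) ⟩
  ∑[ u ∈ W j ] (2 * ∑ (W k) (subword u) + ∑ (W (suc k)) (subword u))
    ≡⟨ ∑-+ _ _ (W j) ⟩
  ∑[ u ∈ W j ] (2 * ∑ (W k) (subword u)) + pairs j (suc k)
    ≡⟨ cong (_+ pairs j (suc k)) (∑-scale 2 (λ u → ∑ (W k) (subword u)) (W j)) ⟩
  2 * pairs j k + pairs j (suc k) ∎
  where
  W = wordsOfLength

pairsBelow : ℕ → ℕ → ℕ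
pairsBelow N j = ∑[ k < N ] pairs j k

-- Once the bound exceeds j every subword of a word of length j is counted,
-- and the count is 2·3^j − 2^j.
pairsBelow-value : (j N : ℕ) → j < N → pairsBelow N j + 2 ^ j ≡ 2 * 3 ^ j
pairsBelow-value zero (suc N) _ = begin
  pairsBelow (suc N) 0 + 1                  ≡⟨ cong (_+ 1) (∑<-head (pairs 0) N) ⟩
  (1 + ∑[ k < N ] pairs 0 (suc k)) + 1      ≡⟨ cong (λ t → (1 + t) + 1) (∑<-cong N (λ k _ → pairs-empty k)) ⟩
  (1 + ∑[ k < N ] 0) + 1                    ≡⟨ cong (λ t → (1 + t) + 1) (∑<-zero N) ⟩
  2                                         ∎
pairsBelow-value (suc j) (suc N) (s≤s j<N) = begin
  pairsBelow (suc N) (suc j) + 2 ^ suc j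
    ≡⟨ cong (_+ 2 ^ suc j) (∑<-head (pairs (suc j)) N) ⟩
  (pairs (suc j) 0 + ∑[ k < N ] pairs (suc j) (suc k)) + 2 * p
    ≡⟨ cong₂ (λ a t → (a + t) + 2 * p) (pairs-zero (suc j)) (∑<-cong N (λ k _ → pairs-step j k)) ⟩
  (2 * p + ∑[ k < N ] (2 * pairs j k + pairs j (suc k))) + 2 * p
    ≡⟨ cong (λ t → (2 * p + t) + 2 * p)
            (trans (∑<-+ _ _ N) (cong (_+ r) (∑<-scale 2 (pairs j) N))) ⟩
  (2 * p + (2 * pairsBelow N j + r)) + 2 * p
    ≡⟨ regroup p (pairsBelow N j) r ⟩
  2 * (pairsBelow N j + p) + ((p + r) + p)
    ≡⟨ cong₂ (λ s t → 2 * s + (t + p))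
             (pairsBelow-value j N j<N)
             (trans (cong (_+ r) (sym (pairs-zero j))) (sym (∑<-head (pairs j) N))) ⟩
  2 * (2 * 3 ^ j) + (pairsBelow (suc N) j + p)
    ≡⟨ cong (λ t → 2 * (2 * 3 ^ j) + t)
            (pairsBelow-value j (suc N) (m<n⇒m<1+n j<N)) ⟩
  2 * (2 * 3 ^ j) + 2 * 3 ^ j
    ≡⟨ triple (3 ^ j) ⟩
  2 * 3 ^ suc j ∎
  where
  p = 2 ^ j
  r = ∑[ k < N ] pairs j (suc k)
  regroup : ∀ p g r → (2 * p + (2 * g + r)) + 2 * p ≡ 2 * (g + p) + ((p + r) + p)
  regroup = solve-∀
  triple : ∀ t → 2 * (2 * t) + 2 * t ≡ 2 * (3 * t)
  triple = solve-∀

positive-indicator : (k : ℕ) → (if does (0 <? k) then 1 else 0) ≡ positive k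
positive-indicator zero = refl
positive-indicator (suc k) = refl

count-as-∑ : (n : ℕ) → countPositivePairs n ≡ ∑[ u ∈ Ln n ] ∑[ v ∈ Ln n ] subword u v
count-as-∑ n = begin
  length (filter P? pairsLn)
    ≡⟨ length-as-∑ (filter P? pairsLn) ⟩
  ∑[ p ∈ filter P? pairsLn ] 1
    ≡⟨ ∑-filter P? (λ _ → 1) pairsLn ⟩
  ∑[ p ∈ pairsLn ] (if does (P? p) then 1 else 0)
    ≡⟨ ∑-cong (λ p → positive-indicator (binom (proj₁ p) (proj₂ p))) pairsLn ⟩
  ∑[ p ∈ pairsLn ] subword (proj₁ p) (proj₂ p)
    ≡⟨ ∑-cartesianProduct _ (Ln n) (Ln n) ⟩
  ∑[ u ∈ Ln n ] ∑[ v ∈ Ln n ] subword u v ∎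
  where
  pairsLn : List (Word × Word)
  pairsLn = cartesianProduct (Ln n) (Ln n)
  P? : (p : Word × Word) → Dec (0 < binom (proj₁ p) (proj₂ p))
  P? p = 0 <? binom (proj₁ p) (proj₂ p)

row-empty : (n : ℕ) → ∑[ v ∈ Ln n ] subword [] v ≡ 1
row-empty n = trans (∑-Ln (subword []) n)
  (cong (1 +_) (trans (∑<-cong n (λ j _ → ∑-zero (wordsOfLength j))) (∑<-zero n)))

row-one : (n : ℕ) (u : Word) →
  ∑[ v ∈ Ln n ] subword (true ∷ u) v ≡ 1 + ∑[ k < n ] ∑[ w ∈ wordsOfLength k ] subword u w
row-one n u = trans (∑-Ln (subword (true ∷ u)) n)
  (cong (1 +_) (∑<-cong n (λ k _ → ∑-cong (subword-cons true true u) (wordsOfLength k))))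

rows-of-length : (n j : ℕ) → j < n →
  ∑[ u ∈ wordsOfLength j ] (1 + ∑[ k < n ] ∑[ w ∈ wordsOfLength k ] subword u w) ≡ 2 * 3 ^ j
rows-of-length n j j<n = begin
  ∑[ u ∈ wordsOfLength j ] (1 + ∑[ k < n ] ∑[ w ∈ wordsOfLength k ] subword u w)
    ≡⟨ ∑-+ _ _ (wordsOfLength j) ⟩
  ∑[ u ∈ wordsOfLength j ] 1 + ∑[ u ∈ wordsOfLength j ] ∑[ k < n ] ∑[ w ∈ wordsOfLength k ] subword u w
    ≡⟨ cong₂ _+_ (count-wordsOfLength j)
                 (∑-∑<-comm (λ u k → ∑ (wordsOfLength k) (subword u)) (wordsOfLength j) n) ⟩
  2 ^ j + pairsBelow n j
    ≡⟨ +-comm (2 ^ j) (pairsBelow n j) ⟩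
  pairsBelow n j + 2 ^ j
    ≡⟨ pairsBelow-value j n j<n ⟩
  2 * 3 ^ j ∎

mainTheorem2 : (n : ℕ) → countPositivePairs n ≡ 3 ^ n
mainTheorem2 n = begin
  countPositivePairs n
    ≡⟨ count-as-∑ n ⟩
  ∑[ u ∈ Ln n ] ∑[ v ∈ Ln n ] subword u v
    ≡⟨ ∑-Ln (λ u → ∑ (Ln n) (subword u)) n ⟩
  ∑ (Ln n) (subword []) + ∑[ j < n ] ∑[ u ∈ wordsOfLength j ] ∑ (Ln n) (subword (true ∷ u))
    ≡⟨ cong₂ _+_ (row-empty n) (∑<-cong n (λ j _ → ∑-cong (row-one n) (wordsOfLength j))) ⟩
  1 + ∑[ j < n ] ∑[ u ∈ wordsOfLength j ] (1 + ∑[ k < n ] ∑[ w ∈ wordsOfLength k ] subword u w)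
    ≡⟨ cong (1 +_) (∑<-cong n (rows-of-length n)) ⟩
  1 + ∑[ j < n ] (2 * 3 ^ j)
    ≡⟨ geometric n ⟩
  3 ^ n ∎
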